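{- For every central term $f$ there exist a reduced central term $f'$ and two invertible terms $u$ and $v$ such that $f=v^{ -1}\circ f'\circ u$. Moreover, $u$ and $v$ depend only on the type of $f$, and if $f$ is assorted, then $f'$ is assorted too.
   Context: Formulae are built from an infinite set of propositional letters and a constant $I$ using binary connectives $\otimes$ and $\to$. An $\alpha$-formula is a formula considered up to strict associativity of $\otimes$ and strict unitality of $I$ ($A\otimes(B\otimes C)=(A\otimes B)\otimes C$, $A\otimes I=I\otimes A=A$, also inside subformulae). An $\alpha$-formula is prime if it is not of the form $A\otimes B$ with $A,B$ both different from $I$; every $\alpha$-formula is uniquely $A_1\otimes\dots\otimes A_n$ with $A_i$ prime, its prime factors. An $\alpha$-formula is constant if it contains no letters; it is assorted if all its non-constant prime factors are mutually distinct. Terms with types $f\colon A\vdash B$: primitive $\mathbf 1_A\colon A\vdash A$, $c_{B,A}\colon B\otimes A\vdash A\otimes B$, $\eta_{A,B}\colon B\vdash A\to(A\otimes B)$, $\varepsilon_{A,B}\colon A\otimes(A\to B)\vdash B$; closed under $g\circ f$, $f_1\otimes f_2$, and $A\to f\colon A\to B_1\vdash A\to B_2$ (for $f\colon B_1\vdash B_2$); strictly $f\otimes(g\otimes h)=(f\otimes g)\otimes h$, $f\otimes\mathbf 1_I=\mathbf 1_I\otimes f=f$. Equality of terms is the smallest congruence (only between terms of the same type) containing: $g\circ\mathbf 1_A=g$, $\mathbf 1_A\circ f=f$; $h\circ(g\circ f)=(h\circ g)\circ f$; $\mathbf 1_A\otimes\mathbf 1_B=\mathbf 1_{A\otimes B}$;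 $(g_1\otimes g_2)\circ(f_1\otimes f_2)=(g_1\circ f_1)\otimes(g_2\circ f_2)$; $c_{A',B'}\circ(f\otimes g)=(g\otimes f)\circ c_{A,B}$ ($f\colon A\vdash A'$, $g\colon B\vdash B'$); $c_{B,A}\circ c_{A,B}=\mathbf 1_{A\otimes B}$; $c_{A\otimes B,C}=(c_{A,C}\otimes\mathbf 1_B)\circ(\mathbf 1_A\otimes c_{B,C})$; $A\to(g\circ f)=(A\to g)\circ(A\to f)$; $\eta_{A,B'}\circ f=(A\to(\mathbf 1_A\otimes f))\circ\eta_{A,B}$; $A\to\mathbf 1_B=\mathbf 1_{A\to B}$; $\varepsilon_{A,B'}\circ(\mathbf 1_A\otimes(A\to f))=f\circ\varepsilon_{A,B}$; $\varepsilon_{A,A\otimes B}\circ(\mathbf 1_A\otimes\eta_{A,B})=\mathbf 1_{A\otimes B}$; $(A\to\varepsilon_{A,B})\circ\eta_{A,A\to B}=\mathbf 1_{A\to B}$. A term $f\colon A\vdash B$ is invertible if there is a term $f^{ -1}\colon B\vdash A$ with $f^{ -1}\circ f=\mathbf 1_A$ and $f\circ f^{ -1}=\mathbf 1_B$. A term is central if it contains no $\eta$, no $\varepsilon$ and no use of the operation $A\to(\cdot)$. For a central term $f\colon A\vdash B$: $f$ is non-constant central if $A$ (equivalently $B$) has no constant prime factors; $f$ is $I$-central if $A$ (equivalently $B$) is $I$; $f$ is assorted if $A$ (equivalently $B$) is assorted; $f$ is reduced if it is non-constant central or $I$-central. -}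

module Defs where

open import Data.Nat using (ℕ)
open import Data.List using (List; []; _∷_; _++_; [_]; length; lookup)
open import Data.List.Properties using (++-assoc; ++-identityʳ)
open import Data.List.Relation.Unary.All using (All)
open import Data.Fin using (Fin)
open import Data.Product using (Σ; _×_)
open import Data.Unit using (⊤)
open import Data.Empty using (⊥)
open import Data.Sum using (_⊎_)
open import Relation.Nullary using (¬_)
open import Relation.Binary.PropositionalEquality using (_≡_; _≢_; refl; sym)

-- α-formulae, represented by their canonical form: a list of prime
-- factors.  A prime is either a letter or an implication A → B of
-- α-formulae.  ⊗ is list concatenation and I is the empty list, so
-- strict associativity and unitality (also inside subformulae) hold
-- on the nose up to the propositional equalities ++-assoc / ++-identityʳ.

mutual
  data Prime : Set where
    letter : ℕ → Prime
    _⇒_    : List Prime → List Prime → Prime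

  Form : Set
  Form = List Prime

I : Form
I = []

infixr 6 _⊗_
_⊗_ : Form → Form → Form
_⊗_ = _++_

infixr 5 _⟶_
_⟶_ : Form → Form → Form
A ⟶ B = [ A ⇒ B ]

mutual
  ConstP : Prime → Set
  ConstP (letter _) = ⊥
  ConstP (A ⇒ B)    = ConstF A × ConstF B

  ConstF : Form → Set
  ConstF []       = ⊤
  ConstF (p ∷ ps) = ConstP p × ConstF ps

NoConstFactor : Form → Set
NoConstFactor A = All (λ p → ¬ ConstP p) A

Assorted : Form → Set
Assorted A = (i j : Fin (length A)) → i ≢ j →
             ¬ ConstP (lookup A i) → lookup A i ≢ lookup A j

-- Terms (intrinsically typed: Term A B is the set of terms f : A ⊢ B)

infixr 9 _∘ₜ_
infixr 7 _⊗ₜ_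

data Term : Form → Form → Set where
  𝟏    : ∀ {A} → Term A A
  c    : ∀ B A → Term (B ⊗ A) (A ⊗ B)
  η    : ∀ A B → Term B (A ⟶ (A ⊗ B))
  ε    : ∀ A B → Term (A ⊗ (A ⟶ B)) B
  _∘ₜ_ : ∀ {A B C} → Term B C → Term A B → Term A C
  _⊗ₜ_ : ∀ {A₁ B₁ A₂ B₂} → Term A₁ B₁ → Term A₂ B₂ → Term (A₁ ⊗ A₂) (B₁ ⊗ B₂)
  arr  : ∀ A {B₁ B₂} → Term B₁ B₂ → Term (A ⟶ B₁) (A ⟶ B₂)

cast : ∀ {A A' B B'} → A ≡ A' → B ≡ B' → Term A B → Term A' B'
cast refl refl f = f

-- Equality of terms: the smallest congruence containing the listed
-- equations; the strict identities f⊗(g⊗h)=(f⊗g)⊗h, f⊗1_I = 1_I⊗f = f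
-- on terms are included as equations (needing casts).

infix 4 _≈_
data _≈_ : ∀ {A B} → Term A B → Term A B → Set where
  ≈-refl  : ∀ {A B} {f : Term A B} → f ≈ f
  ≈-sym   : ∀ {A B} {f g : Term A B} → f ≈ g → g ≈ f
  ≈-trans : ∀ {A B} {f g h : Term A B} → f ≈ g → g ≈ h → f ≈ h
  ∘-cong  : ∀ {A B C} {g g' : Term B C} {f f' : Term A B} →
            g ≈ g' → f ≈ f' → g ∘ₜ f ≈ g' ∘ₜ f'
  ⊗-cong  : ∀ {A₁ B₁ A₂ B₂} {f f' : Term A₁ B₁} {g g' : Term A₂ B₂} →
            f ≈ f' → g ≈ g' → f ⊗ₜ g ≈ f' ⊗ₜ g'
  arr-cong : ∀ A {B₁ B₂} {f f' : Term B₁ B₂} → f ≈ f' → arr A f ≈ arr A f'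
  ⊗-assoc : ∀ {A₁ B₁ A₂ B₂ A₃ B₃}
            (f : Term A₁ B₁) (g : Term A₂ B₂) (h : Term A₃ B₃) →
            f ⊗ₜ (g ⊗ₜ h) ≈ cast (++-assoc A₁ A₂ A₃) (++-assoc B₁ B₂ B₃) ((f ⊗ₜ g) ⊗ₜ h)
  ⊗-unitʳ : ∀ {A B} (f : Term A B) →
            f ⊗ₜ 𝟏 {I} ≈ cast (sym (++-identityʳ A)) (sym (++-identityʳ B)) f
  ⊗-unitˡ : ∀ {A B} (f : Term A B) → 𝟏 {I} ⊗ₜ f ≈ f
  idʳ     : ∀ {A B} (g : Term A B) → g ∘ₜ 𝟏 ≈ g
  idˡ     : ∀ {A B} (f : Term A B) → 𝟏 ∘ₜ f ≈ f
  assoc   : ∀ {A B C D} (h : Term C D) (g : Term B C) (f : Term A B) →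
            h ∘ₜ (g ∘ₜ f) ≈ (h ∘ₜ g) ∘ₜ f
  𝟏⊗𝟏     : ∀ {A B} → 𝟏 {A} ⊗ₜ 𝟏 {B} ≈ 𝟏 {A ⊗ B}
  interchange : ∀ {A₁ B₁ C₁ A₂ B₂ C₂}
            (g₁ : Term B₁ C₁) (g₂ : Term B₂ C₂) (f₁ : Term A₁ B₁) (f₂ : Term A₂ B₂) →
            (g₁ ⊗ₜ g₂) ∘ₜ (f₁ ⊗ₜ f₂) ≈ (g₁ ∘ₜ f₁) ⊗ₜ (g₂ ∘ₜ f₂)
  c-nat   : ∀ {A A' B B'} (f : Term A A') (g : Term B B') →
            c A' B' ∘ₜ (f ⊗ₜ g) ≈ (g ⊗ₜ f) ∘ₜ c A B
  c-inv   : ∀ A B → c B A ∘ₜ c A B ≈ 𝟏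
  c-hex   : ∀ A B C →
            c (A ⊗ B) C ≈
            cast (sym (++-assoc A B C)) (++-assoc C A B)
                 ((c A C ⊗ₜ 𝟏 {B}) ∘ₜ cast refl (sym (++-assoc A C B)) (𝟏 {A} ⊗ₜ c B C))
  arr-∘   : ∀ A {B₁ B₂ B₃} (g : Term B₂ B₃) (f : Term B₁ B₂) →
            arr A (g ∘ₜ f) ≈ arr A g ∘ₜ arr A f
  arr-𝟏   : ∀ A B → arr A (𝟏 {B}) ≈ 𝟏
  η-nat   : ∀ A {B B'} (f : Term B B') →
            η A B' ∘ₜ f ≈ arr A (𝟏 {A} ⊗ₜ f) ∘ₜ η A B
  ε-nat   : ∀ A {B B'} (f : Term B B') →
            ε A B' ∘ₜ (𝟏 {A} ⊗ₜ arr A f) ≈ f ∘ₜ ε A B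
  triangle₁ : ∀ A B → ε A (A ⊗ B) ∘ₜ (𝟏 {A} ⊗ₜ η A B) ≈ 𝟏 {A ⊗ B}
  triangle₂ : ∀ A B → arr A (ε A B) ∘ₜ η A (A ⟶ B) ≈ 𝟏 {A ⟶ B}

Invertible : ∀ {A B} → Term A B → Set
Invertible {A} {B} f = Σ (Term B A) λ g → (g ∘ₜ f ≈ 𝟏) × (f ∘ₜ g ≈ 𝟏)

data Central : ∀ {A B} → Term A B → Set where
  𝟏-central : ∀ {A} → Central (𝟏 {A})
  c-central : ∀ A B → Central (c A B)
  ∘-central : ∀ {A B C} {g : Term B C} {f : Term A B} →
              Central g → Central f → Central (g ∘ₜ f)
  ⊗-central : ∀ {A₁ B₁ A₂ B₂} {f : Term A₁ B₁} {g : Term A₂ B₂} →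
              Central f → Central g → Central (f ⊗ₜ g)

-- For a central f : A ⊢ B, the properties below are read off the source A.
NonConstantCentral : ∀ {A B} → Term A B → Set
NonConstantCentral {A} f = Central f × NoConstFactor A

ICentral : ∀ {A B} → Term A B → Set
ICentral {A} f = Central f × A ≡ I

ReducedCentral : ∀ {A B} → Term A B → Set
ReducedCentral f = NonConstantCentral f ⊎ ICentral f

AssortedTerm : ∀ {A B} → Term A B → Set
AssortedTerm {A} f = Assorted A

{-# OPTIONS --safe #-}
-- Every constant prime is isomorphic to I: if A ≅ I then A → B ≅ B, via the
-- adjunction A ⊗ (·) ⊣ A → (·).  Tensoring these isomorphisms gives an
-- invertible strip A : A ⊢ A', where A' lists the non-constant prime factors
-- of A.  Stripping is monoidal, so it commutes with c and ⊗, and every central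
-- f : A ⊢ B satisfies strip B ∘ f = f' ∘ strip A for the central term f'
-- obtained by replacing each c_{X,Y} in f with c_{X',Y'}.  As A' is a sublist
-- of A, it is assorted when A is.
module Submission where

open import Defs
open import Data.Product using (Σ; _×_; _,_; proj₁; proj₂)
open import Data.Sum using (inj₁)
open import Data.Unit using (tt)
open import Data.Fin using (Fin; zero; suc)
open import Data.Fin.Properties using (suc-injective)
open import Data.List using (List; []; _∷_; _++_; [_]; length; lookup; filter)
open import Data.List.Properties using (++-assoc; filter-++)
open import Data.List.Relation.Unary.All.Properties using (all-filter)
open import Data.List.Relation.Binary.Sublist.Propositional using (_⊆_; _∷_; _∷ʳ_)
open import Data.List.Relation.Binary.Sublist.Propositional.Properties using (filter-⊆)
open import Function using (_∘_)
open import Function.Definitions using (Injective)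
open import Relation.Binary.Bundles using (Setoid)
open import Relation.Nullary using (yes; no)
open import Relation.Nullary.Decidable using (_×-dec_)
open import Relation.Unary using (Decidable; ∁)
open import Relation.Unary.Properties using (∁?)
open import Relation.Binary.PropositionalEquality using (_≡_; refl; sym; trans; cong; subst)
import Relation.Binary.Reasoning.Setoid as SetoidReasoning

Term-setoid : Form → Form → Setoid _ _
Term-setoid A B = record
  { Carrier       = Term A B
  ; _≈_           = _≈_
  ; isEquivalence = record { refl = ≈-refl ; sym = ≈-sym ; trans = ≈-trans }
  }

module ≈-Reasoning {A B : Form} = SetoidReasoning (Term-setoid A B)
open ≈-Reasoning

∘-cancel-inner : ∀ {A B C E} {f : Term C E} {h : Term B C} {k : Term C B} {g : Term A C} →
                 h ∘ₜ k ≈ 𝟏 → (f ∘ₜ h) ∘ₜ (k ∘ₜ g) ≈ f ∘ₜ g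
∘-cancel-inner {f = f} {h} {k} {g} h∘k≈𝟏 = begin
  (f ∘ₜ h) ∘ₜ (k ∘ₜ g)   ≈⟨ assoc _ _ _ ⟩
  ((f ∘ₜ h) ∘ₜ k) ∘ₜ g   ≈⟨ ∘-cong (≈-sym (assoc _ _ _)) ≈-refl ⟩
  (f ∘ₜ (h ∘ₜ k)) ∘ₜ g   ≈⟨ ∘-cong (∘-cong ≈-refl h∘k≈𝟏) ≈-refl ⟩
  (f ∘ₜ 𝟏) ∘ₜ g          ≈⟨ ∘-cong (idʳ f) ≈-refl ⟩
  f ∘ₜ g                 ∎

transpose-⁻¹ : ∀ {A A′ B B′} {f : Term A B} {f′ : Term A′ B′} {u : Term A A′}
               {v : Term B B′} {v⁻¹ : Term B′ B} →
               v⁻¹ ∘ₜ v ≈ 𝟏 → v ∘ₜ f ≈ f′ ∘ₜ u → f ≈ (v⁻¹ ∘ₜ f′) ∘ₜ u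
transpose-⁻¹ {f = f} {f′} {u} {v} {v⁻¹} v⁻¹∘v≈𝟏 v∘f≈f′∘u = begin
  f                      ≈⟨ idˡ f ⟨
  𝟏 ∘ₜ f                 ≈⟨ ∘-cong v⁻¹∘v≈𝟏 ≈-refl ⟨
  (v⁻¹ ∘ₜ v) ∘ₜ f        ≈⟨ assoc _ _ _ ⟨
  v⁻¹ ∘ₜ (v ∘ₜ f)        ≈⟨ ∘-cong ≈-refl v∘f≈f′∘u ⟩
  v⁻¹ ∘ₜ (f′ ∘ₜ u)       ≈⟨ assoc _ _ _ ⟩
  (v⁻¹ ∘ₜ f′) ∘ₜ u       ∎

𝟏⊗-∘ : ∀ {X A B C} (g : Term B C) (f : Term A B) →
       𝟏 {X} ⊗ₜ (g ∘ₜ f) ≈ (𝟏 ⊗ₜ g) ∘ₜ (𝟏 ⊗ₜ f)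
𝟏⊗-∘ g f = ≈-sym (≈-trans (interchange 𝟏 g 𝟏 f) (⊗-cong (idˡ 𝟏) ≈-refl))

⊗≈⊗𝟏∘𝟏⊗ : ∀ {A₁ B₁ A₂ B₂} (f : Term A₁ B₁) (g : Term A₂ B₂) →
           f ⊗ₜ g ≈ (f ⊗ₜ 𝟏) ∘ₜ (𝟏 ⊗ₜ g)
⊗≈⊗𝟏∘𝟏⊗ f g = ≈-sym (≈-trans (interchange f 𝟏 𝟏 g) (⊗-cong (idʳ f) (idˡ g)))

⊗≈𝟏⊗∘⊗𝟏 : ∀ {A₁ B₁ A₂ B₂} (f : Term A₁ B₁) (g : Term A₂ B₂) →
           f ⊗ₜ g ≈ (𝟏 ⊗ₜ g) ∘ₜ (f ⊗ₜ 𝟏)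
⊗≈𝟏⊗∘⊗𝟏 f g = ≈-sym (≈-trans (interchange 𝟏 g f 𝟏) (⊗-cong (idˡ f) (idʳ g)))

⊗-into-I : ∀ {X Y Z} (a : Term X I) (h : Term Y Z) → a ⊗ₜ h ≈ h ∘ₜ (a ⊗ₜ 𝟏)
⊗-into-I a h = ≈-trans (⊗≈𝟏⊗∘⊗𝟏 a h) (∘-cong (⊗-unitˡ h) ≈-refl)

⊗𝟏-from-I-natural : ∀ {X Y Z} (b : Term I X) (h : Term Y Z) →
                    (b ⊗ₜ 𝟏) ∘ₜ h ≈ (𝟏 ⊗ₜ h) ∘ₜ (b ⊗ₜ 𝟏)
⊗𝟏-from-I-natural b h = begin
  (b ⊗ₜ 𝟏) ∘ₜ h             ≈⟨ ∘-cong ≈-refl (⊗-unitˡ h) ⟨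
  (b ⊗ₜ 𝟏) ∘ₜ (𝟏 {I} ⊗ₜ h)  ≈⟨ ⊗≈⊗𝟏∘𝟏⊗ b h ⟨
  b ⊗ₜ h                    ≈⟨ ⊗≈𝟏⊗∘⊗𝟏 b h ⟩
  (𝟏 ⊗ₜ h) ∘ₜ (b ⊗ₜ 𝟏)      ∎

infix 4 _≅_
_≅_ : Form → Form → Set
A ≅ B = Σ (Term A B) Invertible

≅-refl : ∀ {A} → A ≅ A
≅-refl = 𝟏 , 𝟏 , idˡ 𝟏 , idˡ 𝟏

≅-trans : ∀ {A B C} → A ≅ B → B ≅ C → A ≅ C
≅-trans (f , f⁻¹ , f⁻¹∘f , f∘f⁻¹) (g , g⁻¹ , g⁻¹∘g , g∘g⁻¹) =
  g ∘ₜ f , f⁻¹ ∘ₜ g⁻¹ ,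
  ≈-trans (∘-cancel-inner g⁻¹∘g) f⁻¹∘f ,
  ≈-trans (∘-cancel-inner f∘f⁻¹) g∘g⁻¹

infixr 7 _⊗≅_
_⊗≅_ : ∀ {A₁ B₁ A₂ B₂} → A₁ ≅ B₁ → A₂ ≅ B₂ → A₁ ⊗ A₂ ≅ B₁ ⊗ B₂
(f , f⁻¹ , f⁻¹∘f , f∘f⁻¹) ⊗≅ (g , g⁻¹ , g⁻¹∘g , g∘g⁻¹) =
  f ⊗ₜ g , f⁻¹ ⊗ₜ g⁻¹ ,
  ≈-trans (interchange f⁻¹ g⁻¹ f g) (≈-trans (⊗-cong f⁻¹∘f g⁻¹∘g) 𝟏⊗𝟏) ,
  ≈-trans (interchange f g f⁻¹ g⁻¹) (≈-trans (⊗-cong f∘f⁻¹ g∘g⁻¹) 𝟏⊗𝟏)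

≅I⇒⟶-≅ : ∀ {A} B → A ≅ I → A ⟶ B ≅ B
≅I⇒⟶-≅ {A} B A≅I@(a , a⁻¹ , _) = to , from , from∘to , to∘from
  where
  a⊗𝟏⁻¹∘a⊗𝟏 : (a⁻¹ ⊗ₜ 𝟏) ∘ₜ (a ⊗ₜ 𝟏) ≈ 𝟏 {A ⊗ (A ⟶ B)}
  a⊗𝟏⁻¹∘a⊗𝟏 = proj₁ (proj₂ (proj₂ (A≅I ⊗≅ ≅-refl)))

  a⊗𝟏∘a⊗𝟏⁻¹ : (a ⊗ₜ 𝟏) ∘ₜ (a⁻¹ ⊗ₜ 𝟏) ≈ 𝟏 {B}
  a⊗𝟏∘a⊗𝟏⁻¹ = proj₂ (proj₂ (proj₂ (A≅I ⊗≅ ≅-refl)))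

  -- to and from transpose a⁻¹ ⊗ 𝟏 and a ⊗ 𝟏 across the adjunction.
  to : Term (A ⟶ B) B
  to = ε A B ∘ₜ (a⁻¹ ⊗ₜ 𝟏)

  from : Term B (A ⟶ B)
  from = arr A (a ⊗ₜ 𝟏) ∘ₜ η A B

  to-transpose : (a ⊗ₜ 𝟏) ∘ₜ (𝟏 ⊗ₜ to) ≈ ε A B
  to-transpose = begin
    (a ⊗ₜ 𝟏) ∘ₜ (𝟏 ⊗ₜ to)             ≈⟨ ⊗≈⊗𝟏∘𝟏⊗ a to ⟨
    a ⊗ₜ to                           ≈⟨ ⊗-into-I a to ⟩
    (ε A B ∘ₜ (a⁻¹ ⊗ₜ 𝟏)) ∘ₜ (a ⊗ₜ 𝟏)  ≈⟨ assoc _ _ _ ⟨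
    ε A B ∘ₜ ((a⁻¹ ⊗ₜ 𝟏) ∘ₜ (a ⊗ₜ 𝟏))  ≈⟨ ∘-cong ≈-refl a⊗𝟏⁻¹∘a⊗𝟏 ⟩
    ε A B ∘ₜ 𝟏                        ≈⟨ idʳ _ ⟩
    ε A B                             ∎

  from∘to : from ∘ₜ to ≈ 𝟏
  from∘to = begin
    (arr A (a ⊗ₜ 𝟏) ∘ₜ η A B) ∘ₜ to                     ≈⟨ assoc _ _ _ ⟨
    arr A (a ⊗ₜ 𝟏) ∘ₜ (η A B ∘ₜ to)                     ≈⟨ ∘-cong ≈-refl (η-nat A to) ⟩
    arr A (a ⊗ₜ 𝟏) ∘ₜ (arr A (𝟏 ⊗ₜ to) ∘ₜ η A (A ⟶ B))  ≈⟨ assoc _ _ _ ⟩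
    (arr A (a ⊗ₜ 𝟏) ∘ₜ arr A (𝟏 ⊗ₜ to)) ∘ₜ η A (A ⟶ B)  ≈⟨ ∘-cong (arr-∘ A _ _) ≈-refl ⟨
    arr A ((a ⊗ₜ 𝟏) ∘ₜ (𝟏 ⊗ₜ to)) ∘ₜ η A (A ⟶ B)        ≈⟨ ∘-cong (arr-cong A to-transpose) ≈-refl ⟩
    arr A (ε A B) ∘ₜ η A (A ⟶ B)                        ≈⟨ triangle₂ A B ⟩
    𝟏                                                   ∎

  to∘from : to ∘ₜ from ≈ 𝟏
  to∘from = begin
    (ε A B ∘ₜ (a⁻¹ ⊗ₜ 𝟏)) ∘ₜ from                              ≈⟨ assoc _ _ _ ⟨
    ε A B ∘ₜ ((a⁻¹ ⊗ₜ 𝟏) ∘ₜ from)                              ≈⟨ ∘-cong ≈-refl (⊗𝟏-from-I-natural a⁻¹ from) ⟩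
    ε A B ∘ₜ ((𝟏 ⊗ₜ from) ∘ₜ (a⁻¹ ⊗ₜ 𝟏))                       ≈⟨ ∘-cong ≈-refl (∘-cong (𝟏⊗-∘ _ _) ≈-refl) ⟩
    ε A B ∘ₜ (((𝟏 ⊗ₜ arr A (a ⊗ₜ 𝟏)) ∘ₜ (𝟏 ⊗ₜ η A B)) ∘ₜ (a⁻¹ ⊗ₜ 𝟏))
                                                              ≈⟨ ∘-cong ≈-refl (assoc _ _ _) ⟨
    ε A B ∘ₜ ((𝟏 ⊗ₜ arr A (a ⊗ₜ 𝟏)) ∘ₜ ((𝟏 ⊗ₜ η A B) ∘ₜ (a⁻¹ ⊗ₜ 𝟏)))
                                                              ≈⟨ assoc _ _ _ ⟩
    (ε A B ∘ₜ (𝟏 ⊗ₜ arr A (a ⊗ₜ 𝟏))) ∘ₜ ((𝟏 ⊗ₜ η A B) ∘ₜ (a⁻¹ ⊗ₜ 𝟏))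
                                                              ≈⟨ ∘-cong (ε-nat A (a ⊗ₜ 𝟏)) ≈-refl ⟩
    ((a ⊗ₜ 𝟏) ∘ₜ ε A (A ⊗ B)) ∘ₜ ((𝟏 ⊗ₜ η A B) ∘ₜ (a⁻¹ ⊗ₜ 𝟏)) ≈⟨ ∘-cancel-inner (triangle₁ A B) ⟩
    (a ⊗ₜ 𝟏) ∘ₜ (a⁻¹ ⊗ₜ 𝟏)                                    ≈⟨ a⊗𝟏∘a⊗𝟏⁻¹ ⟩
    𝟏                                                         ∎

mutual
  constP-≅-I : (p : Prime) → ConstP p → [ p ] ≅ I
  constP-≅-I (letter _) ()
  constP-≅-I (A ⇒ B) (constA , constB) =
    ≅-trans (≅I⇒⟶-≅ B (constF-≅-I A constA)) (constF-≅-I B constB)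

  constF-≅-I : (A : Form) → ConstF A → A ≅ I
  constF-≅-I []      _                = ≅-refl
  constF-≅-I (p ∷ A) (constp , constA) = constP-≅-I p constp ⊗≅ constF-≅-I A constA

mutual
  constP? : Decidable ConstP
  constP? (letter _) = no λ ()
  constP? (A ⇒ B)    = constF? A ×-dec constF? B

  constF? : Decidable ConstF
  constF? []      = yes tt
  constF? (p ∷ A) = constP? p ×-dec constF? A

nonConst? : Decidable (∁ ConstP)
nonConst? = ∁? constP?

nonConstFactors : Form → Form
nonConstFactors = filter nonConst?

nonConstFactors-++ : ∀ A B → nonConstFactors A ⊗ nonConstFactors B ≡ nonConstFactors (A ⊗ B)
nonConstFactors-++ A B = sym (filter-++ nonConst? A B)

strip≅ : (A : Form) → A ≅ nonConstFactors A
strip≅ []      = ≅-refl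
strip≅ (p ∷ A) with constP? p
... | yes constp = constP-≅-I p constp ⊗≅ strip≅ A
... | no _       = ≅-refl {[ p ]} ⊗≅ strip≅ A

strip : (A : Form) → Term A (nonConstFactors A)
strip A = proj₁ (strip≅ A)

cast-cong : ∀ {A A' B B'} (e₁ : A ≡ A') (e₂ : B ≡ B') {f g : Term A B} →
            f ≈ g → cast e₁ e₂ f ≈ cast e₁ e₂ g
cast-cong refl refl f≈g = f≈g

cast-cast : ∀ {A A' B C D} {f : Term A B} (e₁ : A ≡ A') (e₂ : B ≡ C) (e₃ : C ≡ D) (e : B ≡ D) →
            cast refl e₃ (cast e₁ e₂ f) ≡ cast e₁ e f
cast-cast refl refl refl refl = refl  -- uses K on e : B ≡ B

⊗-cast : ∀ {X P A B B'} (k : Term X P) (g : Term A B) (e : B ≡ B') →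
         k ⊗ₜ cast refl e g ≡ cast refl (cong (P ⊗_) e) (k ⊗ₜ g)
⊗-cast k g refl = refl

cast-∘ : ∀ {A B C C'} (h : Term B C) (k : Term A B) (e : C ≡ C') →
         cast refl e h ∘ₜ k ≡ cast refl e (h ∘ₜ k)
cast-∘ h k refl = refl

cast-∘-cast : ∀ {A B B' C C'} (h : Term B C) (k : Term A B) (e₁ : B ≡ B') (e₂ : C ≡ C') →
              cast e₁ e₂ h ∘ₜ cast refl e₁ k ≡ cast refl e₂ (h ∘ₜ k)
cast-∘-cast h k refl refl = refl

cast-central : ∀ {A A' B B'} {f : Term A B} (e₁ : A ≡ A') (e₂ : B ≡ B') →
               Central f → Central (cast e₁ e₂ f)
cast-central refl refl central-f = central-f

⊗ˡ-split : ∀ {X P A B F G H} (k : Term X P) {f : Term A F} {g : Term B G} {h : Term (A ⊗ B) H}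
            (e′ : F ⊗ G ≡ H) (e : (P ⊗ F) ⊗ G ≡ P ⊗ H) →
            h ≈ cast refl e′ (f ⊗ₜ g) →
            k ⊗ₜ h ≈ cast (++-assoc X A B) e ((k ⊗ₜ f) ⊗ₜ g)
⊗ˡ-split {X} {P} {A} {B} {F} {G} k {f} {g} {h} e′ e h≈f⊗g = begin
  k ⊗ₜ h                                       ≈⟨ ⊗-cong ≈-refl h≈f⊗g ⟩
  k ⊗ₜ cast refl e′ (f ⊗ₜ g)                   ≡⟨ ⊗-cast k (f ⊗ₜ g) e′ ⟩
  cast refl (cong (P ⊗_) e′) (k ⊗ₜ (f ⊗ₜ g))    ≈⟨ cast-cong refl (cong (P ⊗_) e′) (⊗-assoc k f g) ⟩
  cast refl (cong (P ⊗_) e′) (cast (++-assoc X A B) (++-assoc P F G) ((k ⊗ₜ f) ⊗ₜ g))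
                                               ≡⟨ cast-cast (++-assoc X A B) (++-assoc P F G) (cong (P ⊗_) e′) e ⟩
  cast (++-assoc X A B) e ((k ⊗ₜ f) ⊗ₜ g)       ∎

strip-++ : ∀ A B (e : nonConstFactors A ⊗ nonConstFactors B ≡ nonConstFactors (A ⊗ B)) →
           strip (A ⊗ B) ≈ cast refl e (strip A ⊗ₜ strip B)
strip-++ []      B refl = ≈-sym (⊗-unitˡ (strip B))
strip-++ (p ∷ A) B e with constP? p
... | yes constp = ⊗ˡ-split (proj₁ (constP-≅-I p constp)) _ e (strip-++ A B (nonConstFactors-++ A B))
... | no _       = ⊗ˡ-split 𝟏 _ e (strip-++ A B (nonConstFactors-++ A B))

reduce : ∀ {A B} {f : Term A B} → Central f → Term (nonConstFactors A) (nonConstFactors B)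
reduce 𝟏-central                                  = 𝟏
reduce (c-central A B)                            =
  cast (nonConstFactors-++ A B) (nonConstFactors-++ B A) (c (nonConstFactors A) (nonConstFactors B))
reduce (∘-central central-g central-f)            = reduce central-g ∘ₜ reduce central-f
reduce (⊗-central {A₁} {B₁} {A₂} {B₂} central-f central-g) =
  cast (nonConstFactors-++ A₁ A₂) (nonConstFactors-++ B₁ B₂) (reduce central-f ⊗ₜ reduce central-g)

reduce-central : ∀ {A B} {f : Term A B} (central-f : Central f) → Central (reduce central-f)
reduce-central 𝟏-central                                  = 𝟏-central
reduce-central (c-central A B)                            =
  cast-central (nonConstFactors-++ A B) (nonConstFactors-++ B A) (c-central _ _)
reduce-central (∘-central central-g central-f)            =
  ∘-central (reduce-central central-g) (reduce-central central-f)
reduce-central (⊗-central {A₁} {B₁} {A₂} {B₂} central-f central-g) =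
  cast-central (nonConstFactors-++ A₁ A₂) (nonConstFactors-++ B₁ B₂)
               (⊗-central (reduce-central central-f) (reduce-central central-g))

strip-natural : ∀ {A B} {f : Term A B} (central-f : Central f) →
                strip B ∘ₜ f ≈ reduce central-f ∘ₜ strip A
strip-natural {A} 𝟏-central = ≈-trans (idʳ (strip A)) (≈-sym (idˡ (strip A)))
strip-natural (c-central A B) = begin
  strip (B ⊗ A) ∘ₜ c A B                              ≈⟨ ∘-cong (strip-++ B A eBA) ≈-refl ⟩
  cast refl eBA (strip B ⊗ₜ strip A) ∘ₜ c A B         ≡⟨ cast-∘ _ _ eBA ⟩
  cast refl eBA ((strip B ⊗ₜ strip A) ∘ₜ c A B)       ≈⟨ cast-cong refl eBA (c-nat (strip A) (strip B)) ⟨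
  cast refl eBA (c′ ∘ₜ (strip A ⊗ₜ strip B))          ≡⟨ cast-∘-cast c′ _ eAB eBA ⟨
  cast eAB eBA c′ ∘ₜ cast refl eAB (strip A ⊗ₜ strip B) ≈⟨ ∘-cong ≈-refl (strip-++ A B eAB) ⟨
  cast eAB eBA c′ ∘ₜ strip (A ⊗ B)                    ∎
  where
  eAB = nonConstFactors-++ A B
  eBA = nonConstFactors-++ B A
  c′  = c (nonConstFactors A) (nonConstFactors B)
strip-natural {A} {C} (∘-central {B = B} {g = g} {f = f} central-g central-f) = begin
  strip C ∘ₜ (g ∘ₜ f)                              ≈⟨ assoc _ _ _ ⟩
  (strip C ∘ₜ g) ∘ₜ f                              ≈⟨ ∘-cong (strip-natural central-g) ≈-refl ⟩
  (reduce central-g ∘ₜ strip B) ∘ₜ f               ≈⟨ assoc _ _ _ ⟨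
  reduce central-g ∘ₜ (strip B ∘ₜ f)               ≈⟨ ∘-cong ≈-refl (strip-natural central-f) ⟩
  reduce central-g ∘ₜ (reduce central-f ∘ₜ strip A) ≈⟨ assoc _ _ _ ⟩
  (reduce central-g ∘ₜ reduce central-f) ∘ₜ strip A ∎
strip-natural (⊗-central {A₁} {B₁} {A₂} {B₂} {f} {g} central-f central-g) = begin
  strip (B₁ ⊗ B₂) ∘ₜ (f ⊗ₜ g)                        ≈⟨ ∘-cong (strip-++ B₁ B₂ eB) ≈-refl ⟩
  cast refl eB (strip B₁ ⊗ₜ strip B₂) ∘ₜ (f ⊗ₜ g)    ≡⟨ cast-∘ _ _ eB ⟩
  cast refl eB ((strip B₁ ⊗ₜ strip B₂) ∘ₜ (f ⊗ₜ g))  ≈⟨ cast-cong refl eB (interchange _ _ _ _) ⟩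
  cast refl eB ((strip B₁ ∘ₜ f) ⊗ₜ (strip B₂ ∘ₜ g))  ≈⟨ cast-cong refl eB (⊗-cong (strip-natural central-f)
                                                                                 (strip-natural central-g)) ⟩
  cast refl eB ((f′ ∘ₜ strip A₁) ⊗ₜ (g′ ∘ₜ strip A₂)) ≈⟨ cast-cong refl eB (interchange _ _ _ _) ⟨
  cast refl eB ((f′ ⊗ₜ g′) ∘ₜ (strip A₁ ⊗ₜ strip A₂)) ≡⟨ cast-∘-cast _ _ eA eB ⟨
  cast eA eB (f′ ⊗ₜ g′) ∘ₜ cast refl eA (strip A₁ ⊗ₜ strip A₂) ≈⟨ ∘-cong ≈-refl (strip-++ A₁ A₂ eA) ⟨
  cast eA eB (f′ ⊗ₜ g′) ∘ₜ strip (A₁ ⊗ A₂)            ∎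
  where
  eA = nonConstFactors-++ A₁ A₂
  eB = nonConstFactors-++ B₁ B₂
  f′ = reduce central-f
  g′ = reduce central-g

⊆-index : ∀ {a} {X : Set a} {xs ys : List X} → xs ⊆ ys → Fin (length xs) → Fin (length ys)
⊆-index (_ ∷ʳ xs⊆ys) i       = suc (⊆-index xs⊆ys i)
⊆-index (_ ∷ xs⊆ys)  zero    = zero
⊆-index (_ ∷ xs⊆ys)  (suc i) = suc (⊆-index xs⊆ys i)

⊆-index-injective : ∀ {a} {X : Set a} {xs ys : List X} (xs⊆ys : xs ⊆ ys) →
                    Injective _≡_ _≡_ (⊆-index xs⊆ys)
⊆-index-injective (_ ∷ʳ xs⊆ys)                  eq = ⊆-index-injective xs⊆ys (suc-injective eq)
⊆-index-injective (_ ∷ _)      {zero}  {zero}  _  = refl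
⊆-index-injective (_ ∷ xs⊆ys)  {suc i} {suc j} eq = cong suc (⊆-index-injective xs⊆ys (suc-injective eq))

lookup-⊆-index : ∀ {a} {X : Set a} {xs ys : List X} (xs⊆ys : xs ⊆ ys) (i : Fin (length xs)) →
                 lookup ys (⊆-index xs⊆ys i) ≡ lookup xs i
lookup-⊆-index (_ ∷ʳ xs⊆ys) i       = lookup-⊆-index xs⊆ys i
lookup-⊆-index (refl ∷ _)   zero    = refl
lookup-⊆-index (_ ∷ xs⊆ys)  (suc i) = lookup-⊆-index xs⊆ys i

Assorted-⊆ : ∀ {A B} → A ⊆ B → Assorted B → Assorted A
Assorted-⊆ A⊆B assorted-B i j i≢j nonconst-i Ai≡Aj =
  assorted-B (index i) (index j)
    (i≢j ∘ ⊆-index-injective A⊆B)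
    (nonconst-i ∘ subst ConstP (lookup-⊆-index A⊆B i))
    (trans (lookup-⊆-index A⊆B i) (trans Ai≡Aj (sym (lookup-⊆-index A⊆B j))))
  where
  index = ⊆-index A⊆B

lemma4p13 : (A B : Form) →
    Σ Form λ A' → Σ Form λ B' →
    Σ (Term A A') λ u → Σ (Term B B') λ v →
    Σ (Invertible u) λ invU → Σ (Invertible v) λ invV →
    (f : Term A B) → Central f →
    Σ (Term A' B') λ f' →
      ReducedCentral f' ×
      (AssortedTerm f → AssortedTerm f') ×
      (f ≈ (proj₁ invV ∘ₜ f') ∘ₜ u)
lemma4p13 A B =
  nonConstFactors A , nonConstFactors B , strip A , strip B , proj₂ (strip≅ A) , proj₂ (strip≅ B) ,
  λ f central-f →
    reduce central-f ,
    inj₁ (reduce-central central-f , all-filter nonConst? A) ,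
    Assorted-⊆ (filter-⊆ nonConst? A) ,
    transpose-⁻¹ (proj₁ (proj₂ (proj₂ (strip≅ B)))) (strip-natural central-f)
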